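{- Let $A$ be an $H^{\vee,\triangle}_3$-algebra and $M$ a non-trivial maximal modal deductive system of $A$. Let $M_0=\{x\in A:\nabla x\notin M\}$, $M_{1/2}=\{x\in A: x\notin M,\ \nabla x\in M\}$, and define $h:A\to\mathbb{C}_3$ by $h(x)=0$ if $x\in M_0$, $h(x)=\frac12$ if $x\in M_{1/2}$, $h(x)=1$ if $x\in M$. Then $h$ is a homomorphism from $A$ to $\mathbb{C}_3^{\to,\vee}$ and $h^{ -1}(\{1\})=M$.
   Context: An $H^{\vee,\triangle}_3$-algebra is an algebra $(A,\to,\vee,\triangle,1)$ such that: $(A,\vee,1)$ is a join-semilattice with top $1$; $x\to(x\vee y)=1$ and $(x\to y)\to((x\vee y)\to y)=1$; whenever the infimum $x\wedge y$ exists, $\triangle(x\wedge y)=\triangle x\wedge\triangle y$; $(A,\to,1)$ satisfies $x\to(y\to x)=1$, $(x\to(y\to z))\to((x\to y)\to(x\to z))=1$, ($x\to y=1=y\to x$ implies $x=y$), and $((x\to y)\to z)\to(((z\to x)\to z)\to z)=1$; and $\triangle x\to x=1$, $((y\to\triangle y)\to(x\to\triangle\triangle x))\to\triangle(x\to y)=\triangle x\to\triangle\triangle y$, $(\triangle x\to\triangle y)\to\triangle x=\triangle x$. Define $\nabla x=(x\to\triangle x)\to\triangle x$. A modal deductive system is $D\subseteq A$ with $1\in D$; $x,x\to y\in D$ implies $y\in D$; $x\in D$ implies $\triangle x\in D$. Maximal means proper and not strictly contained in another proper modal deductive system; non-trivial means $M\ne A$. $\mathbb{C}_3^{\to,\vee}$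 is the chain $\{0<\frac12<1\}$ with $\vee=\max$, $x\to y=1$ if $x\le y$ and $x\to y=y$ otherwise, $\triangle0=\triangle\frac12=0$, $\triangle1=1$. -}

module Defs where

open import Level using (0ℓ)
open import Data.Product using (Σ; _×_; _,_)
open import Relation.Nullary using (¬_)
open import Relation.Binary.PropositionalEquality using (_≡_)
open import Relation.Unary using (Pred; _∈_; _∉_; _⊆_)

record H3Algebra : Set₁ where
  infixr 5 _⇒_
  infixl 6 _∨_
  field
    Carrier : Set
    _⇒_     : Carrier → Carrier → Carrier
    _∨_     : Carrier → Carrier → Carrier
    △       : Carrier → Carrier
    𝟙       : Carrier

  _≤_ : Carrier → Carrier → Set
  x ≤ y = x ∨ y ≡ y

  IsInf : Carrier → Carrier → Carrier → Set
  IsInf z x y = z ≤ x × z ≤ y × (∀ w → w ≤ x → w ≤ y → w ≤ z)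

  field
    ∨-assoc : ∀ x y z → (x ∨ y) ∨ z ≡ x ∨ (y ∨ z)
    ∨-comm  : ∀ x y → x ∨ y ≡ y ∨ x
    ∨-idem  : ∀ x → x ∨ x ≡ x
    ∨-top   : ∀ x → x ∨ 𝟙 ≡ 𝟙
    ax∨1 : ∀ x y → x ⇒ (x ∨ y) ≡ 𝟙
    ax∨2 : ∀ x y → (x ⇒ y) ⇒ ((x ∨ y) ⇒ y) ≡ 𝟙
    -- △(x ∧ y) = △x ∧ △y whenever x ∧ y exists
    ax△∧ : ∀ x y z → IsInf z x y → IsInf (△ z) (△ x) (△ y)
    axK  : ∀ x y → x ⇒ (y ⇒ x) ≡ 𝟙
    axS  : ∀ x y z → (x ⇒ (y ⇒ z)) ⇒ ((x ⇒ y) ⇒ (x ⇒ z)) ≡ 𝟙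
    axAS : ∀ x y → x ⇒ y ≡ 𝟙 → y ⇒ x ≡ 𝟙 → x ≡ y
    axH3 : ∀ x y z → ((x ⇒ y) ⇒ z) ⇒ (((z ⇒ x) ⇒ z) ⇒ z) ≡ 𝟙
    ax△1 : ∀ x → △ x ⇒ x ≡ 𝟙
    ax△2 : ∀ x y → ((y ⇒ △ y) ⇒ (x ⇒ △ (△ x))) ⇒ △ (x ⇒ y) ≡ △ x ⇒ △ (△ y)
    ax△3 : ∀ x y → (△ x ⇒ △ y) ⇒ △ x ≡ △ x

  ∇ : Carrier → Carrier
  ∇ x = (x ⇒ △ x) ⇒ △ x

  record IsModalDS (D : Pred Carrier 0ℓ) : Set where
    field
      one∈ : 𝟙 ∈ D
      mp   : ∀ {x y} → x ∈ D → (x ⇒ y) ∈ D → y ∈ D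
      nec  : ∀ {x} → x ∈ D → △ x ∈ D

  Proper : Pred Carrier 0ℓ → Set
  Proper D = ¬ (∀ x → x ∈ D)

  record IsMaximalModalDS (M : Pred Carrier 0ℓ) : Set₁ where
    field
      isModalDS : IsModalDS M
      proper    : Proper M
      maximal   : ∀ (D : Pred Carrier 0ℓ) → IsModalDS D → Proper D → M ⊆ D → D ⊆ M

  NonTrivial : Pred Carrier 0ℓ → Set
  NonTrivial M = ¬ (∀ x → x ∈ M)

data C3 : Set where
  c0 c½ c1 : C3

-- x → y = 1 if x ≤ y, and y otherwise
_⇒C_ : C3 → C3 → C3
c0 ⇒C y  = c1
c½ ⇒C c0 = c0
c½ ⇒C c½ = c1
c½ ⇒C c1 = c1
c1 ⇒C y  = y

_∨C_ : C3 → C3 → C3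
c0 ∨C y  = y
c½ ∨C c0 = c½
c½ ∨C c½ = c½
c½ ∨C c1 = c1
c1 ∨C y  = c1

△C : C3 → C3
△C c0 = c0
△C c½ = c0
△C c1 = c1

record IsHom (A : H3Algebra) (h : H3Algebra.Carrier A → C3) : Set where
  open H3Algebra A
  field
    hom-⇒ : ∀ x y → h (x ⇒ y) ≡ h x ⇒C h y
    hom-∨ : ∀ x y → h (x ∨ y) ≡ h x ∨C h y
    hom-△ : ∀ x → h (△ x) ≡ △C (h x)
    hom-1 : h 𝟙 ≡ c1

{-# OPTIONS --safe #-}
module Submission where

-- If x ∉ M, then {z ∣ △x ⇒ z ∈ M} is a modal deductive system containing M
-- and x, so by maximality it is everything: modulo M, △x behaves like 0.
-- Since x ⇒ △x ⇒ △(x ⇒ △x) is a theorem, x ⇒ △x is then either in M or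
-- behaves like 0 itself, and h x = 0 exactly when x behaves like 0.  With
-- this, preservation of ⇒ and △ is a case analysis on the values of h, and
-- preservation of ∨ follows because in C₃ the join is characterised by the
-- two ∨-axioms.

open import Defs
open import Level using (0ℓ)
open import Data.Product using (_×_; _,_; proj₁)
open import Function.Bundles using (_⇔_; Equivalence)
open import Relation.Binary.PropositionalEquality
  using (_≡_; _≢_; refl; sym; trans; subst; cong₂)
open import Relation.Nullary using (yes; no)
open import Relation.Nullary.Decidable using (decidable-stable)
open import Relation.Unary using (Pred; _∈_; _∉_; Decidable)

open Equivalence

∨C-unique : ∀ a b c → a ⇒C c ≡ c1 → b ⇒C c ≡ c1 →
            (a ⇒C b) ⇒C (c ⇒C b) ≡ c1 → (b ⇒C a) ⇒C (c ⇒C a) ≡ c1 →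
            c ≡ a ∨C b
∨C-unique c0 c0 c0 _  _  _  _  = refl
∨C-unique c0 c0 c½ _  _  () _
∨C-unique c0 c0 c1 _  _  () _
∨C-unique c0 c½ c0 _  () _  _
∨C-unique c0 c½ c½ _  _  _  _  = refl
∨C-unique c0 c½ c1 _  _  () _
∨C-unique c0 c1 c0 _  () _  _
∨C-unique c0 c1 c½ _  () _  _
∨C-unique c0 c1 c1 _  _  _  _  = refl
∨C-unique c½ c0 c0 () _  _  _
∨C-unique c½ c0 c½ _  _  _  _  = refl
∨C-unique c½ c0 c1 _  _  _  ()
∨C-unique c½ c½ c0 () _  _  _
∨C-unique c½ c½ c½ _  _  _  _  = refl
∨C-unique c½ c½ c1 _  _  () _
∨C-unique c½ c1 c0 () _  _  _
∨C-unique c½ c1 c½ _  () _  _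
∨C-unique c½ c1 c1 _  _  _  _  = refl
∨C-unique c1 c0 c0 () _  _  _
∨C-unique c1 c0 c½ () _  _  _
∨C-unique c1 c0 c1 _  _  _  _  = refl
∨C-unique c1 c½ c0 () _  _  _
∨C-unique c1 c½ c½ () _  _  _
∨C-unique c1 c½ c1 _  _  _  _  = refl
∨C-unique c1 c1 c0 () _  _  _
∨C-unique c1 c1 c½ () _  _  _
∨C-unique c1 c1 c1 _  _  _  _  = refl

module ModalDSProperties
  (A : H3Algebra) {D : Pred (H3Algebra.Carrier A) 0ℓ}
  (isModalDS : H3Algebra.IsModalDS A D) where
  open H3Algebra A
  open IsModalDS isModalDS

  ≡𝟙⇒∈ : ∀ {t} → t ≡ 𝟙 → t ∈ D
  ≡𝟙⇒∈ t≡𝟙 = subst D (sym t≡𝟙) one∈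

  weaken : ∀ {x y} → y ∈ D → (x ⇒ y) ∈ D
  weaken {x} {y} y∈D = mp y∈D (≡𝟙⇒∈ (axK y x))

  ⇒-distrib : ∀ {x y z} → (x ⇒ (y ⇒ z)) ∈ D → (x ⇒ y) ∈ D → (x ⇒ z) ∈ D
  ⇒-distrib {x} {y} {z} p q = mp q (mp p (≡𝟙⇒∈ (axS x y z)))

  ⇒-refl : ∀ {x} → (x ⇒ x) ∈ D
  ⇒-refl {x} = ⇒-distrib (≡𝟙⇒∈ (axK x (x ⇒ x))) (≡𝟙⇒∈ (axK x x))

  ⇒-trans : ∀ {x y z} → (x ⇒ y) ∈ D → (y ⇒ z) ∈ D → (x ⇒ z) ∈ D
  ⇒-trans p q = ⇒-distrib (weaken q) p

  ⇒-monoʳ : ∀ {x y z} → (y ⇒ z) ∈ D → ((x ⇒ y) ⇒ (x ⇒ z)) ∈ D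
  ⇒-monoʳ {x} {y} {z} p = mp (weaken p) (≡𝟙⇒∈ (axS x y z))

  ⇒-apply : ∀ {x y} → x ∈ D → ((x ⇒ y) ⇒ y) ∈ D
  ⇒-apply {x} {y} x∈D =
    mp (weaken x∈D) (mp ⇒-refl (≡𝟙⇒∈ (axS (x ⇒ y) x y)))

  -- Instances of ax△2 whose left-hand side is in D by weakening.
  △⇒△△ : ∀ {x} → (△ x ⇒ △ (△ x)) ∈ D
  △⇒△△ {x} = subst D (ax△2 x x) (weaken (nec ⇒-refl))

  △△⇒△△ : ∀ {x y} → (△ x ⇒ y) ∈ D → (△ (△ x) ⇒ △ (△ y)) ∈ D
  △△⇒△△ {x} {y} p = subst D (ax△2 (△ x) y) (weaken (nec p))

  ⇒△-△-closed : ∀ {x} → ((x ⇒ △ x) ⇒ △ (x ⇒ △ x)) ∈ D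
  ⇒△-△-closed {x} = ⇒-trans premise conclusion
    where
    premise : ((x ⇒ △ x) ⇒ ((△ x ⇒ △ (△ x)) ⇒ (x ⇒ △ (△ x)))) ∈ D
    premise = ⇒-trans (⇒-monoʳ △⇒△△)
                      (≡𝟙⇒∈ (axK (x ⇒ △ (△ x)) (△ x ⇒ △ (△ x))))
    conclusion : (((△ x ⇒ △ (△ x)) ⇒ (x ⇒ △ (△ x))) ⇒ △ (x ⇒ △ x)) ∈ D
    conclusion = subst D (sym (ax△2 x (△ x))) (⇒-trans △⇒△△ △⇒△△)

  △-section-isModalDS : ∀ u → IsModalDS (λ z → (△ u ⇒ z) ∈ D)
  △-section-isModalDS u = record
    { one∈ = weaken one∈
    ; mp   = λ p q → ⇒-distrib q p
    ; nec  = λ {y} p →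
        ⇒-trans △⇒△△ (⇒-trans (△△⇒△△ p) (≡𝟙⇒∈ (ax△1 (△ y))))
    }

module MaximalModalDSProperties
  (A : H3Algebra) {M : Pred (H3Algebra.Carrier A) 0ℓ}
  (isMaximal : H3Algebra.IsMaximalModalDS A M) (_∈M? : Decidable M) where
  open H3Algebra A
  open IsMaximalModalDS isMaximal
  open IsModalDS isModalDS
  open ModalDSProperties A isModalDS

  -- Modulo M, x lies below every element, i.e. it behaves like 0.
  Explosive : Carrier → Set
  Explosive x = ∀ w → (x ⇒ w) ∈ M

  explosive-⇒ : ∀ {x y} → (x ⇒ y) ∈ M → Explosive y → Explosive x
  explosive-⇒ x⇒y∈M y-explosive w = ⇒-trans x⇒y∈M (y-explosive w)

  explosive⇒∉ : ∀ {x} → Explosive x → x ∉ M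
  explosive⇒∉ x-explosive x∈M = proper (λ w → mp x∈M (x-explosive w))

  △-explosive : ∀ {x} → x ∉ M → Explosive (△ x)
  △-explosive {x} x∉M w = decidable-stable ((△ x ⇒ w) ∈M?) λ △x⇒w∉M →
    x∉M (maximal _ (△-section-isModalDS x)
                   (λ universal → △x⇒w∉M (universal w))
                   weaken
                   (≡𝟙⇒∈ (ax△1 x)))

  ⇒△-explosive : ∀ {x} → (x ⇒ △ x) ∉ M → Explosive (x ⇒ △ x)
  ⇒△-explosive x⇒△x∉M =
    explosive-⇒ ⇒△-△-closed (△-explosive x⇒△x∉M)

  explosive⇒∇∉ : ∀ {x} → Explosive x → ∇ x ∉ M
  explosive⇒∇∉ {x} x-explosive ∇x∈M = explosive⇒∉ x-explosive
    (mp (mp (x-explosive (△ x)) ∇x∈M) (≡𝟙⇒∈ (ax△1 x)))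

  ∇∉⇒explosive : ∀ {x} → ∇ x ∉ M → Explosive x
  ∇∉⇒explosive {x} ∇x∉M = explosive-⇒ x⇒△x∈M (△-explosive x∉M)
    where
    x⇒△x∈M : (x ⇒ △ x) ∈ M
    x⇒△x∈M = decidable-stable ((x ⇒ △ x) ∈M?) λ x⇒△x∉M →
      ∇x∉M (⇒△-explosive x⇒△x∉M (△ x))
    x∉M : x ∉ M
    x∉M x∈M = ∇x∉M (weaken (mp x∈M x⇒△x∈M))

  Intermediate : Carrier → Set
  Intermediate x = x ∉ M × ∇ x ∈ M

  intermediate⇒⇒△-explosive : ∀ {x} → Intermediate x → Explosive (x ⇒ △ x)
  intermediate⇒⇒△-explosive {x} (x∉M , ∇x∈M) = ⇒△-explosive λ x⇒△x∈M →
    x∉M (mp (mp x⇒△x∈M ∇x∈M) (≡𝟙⇒∈ (ax△1 x)))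

  intermediate-⇒-explosive : ∀ {x y} →
    Intermediate x → Explosive y → Explosive (x ⇒ y)
  intermediate-⇒-explosive {x} x-intermediate y-explosive =
    explosive-⇒ (⇒-monoʳ (y-explosive (△ x)))
                (intermediate⇒⇒△-explosive x-intermediate)

  ∉-⇒-intermediate-∈ : ∀ {x y} → x ∉ M → Intermediate y → (x ⇒ y) ∈ M
  ∉-⇒-intermediate-∈ {x} {y} x∉M y-intermediate =
    mp (mp (intermediate⇒⇒△-explosive y-intermediate (x ⇒ △ (△ x))) ax△2-lhs∈M)
       (≡𝟙⇒∈ (ax△1 (x ⇒ y)))
    where
    ax△2-lhs∈M : (((y ⇒ △ y) ⇒ (x ⇒ △ (△ x))) ⇒ △ (x ⇒ y)) ∈ M
    ax△2-lhs∈M = subst M (sym (ax△2 x y)) (△-explosive x∉M (△ (△ y)))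

  ∈-⇒-explosive : ∀ {x y} → x ∈ M → Explosive y → Explosive (x ⇒ y)
  ∈-⇒-explosive x∈M = explosive-⇒ (⇒-apply x∈M)

  ∈-⇒-intermediate : ∀ {x y} → x ∈ M → Intermediate y → Intermediate (x ⇒ y)
  ∈-⇒-intermediate {x} {y} x∈M (y∉M , ∇y∈M) =
      (λ x⇒y∈M → y∉M (mp x∈M x⇒y∈M))
    , decidable-stable (∇ (x ⇒ y) ∈M?) λ ∇[x⇒y]∉M →
        explosive⇒∇∉ (explosive-⇒ (≡𝟙⇒∈ (axK y x)) (∇∉⇒explosive ∇[x⇒y]∉M)) ∇y∈M

module Classification
  (A : H3Algebra) {M : Pred (H3Algebra.Carrier A) 0ℓ}
  (isMaximal : H3Algebra.IsMaximalModalDS A M)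
  (h : H3Algebra.Carrier A → C3)
  (h≡c0⇔∇∉ : ∀ x → (h x ≡ c0) ⇔ (H3Algebra.∇ A x ∉ M))
  (h≡c½⇔ : ∀ x → (h x ≡ c½) ⇔ (x ∉ M × H3Algebra.∇ A x ∈ M))
  (h≡c1⇔∈ : ∀ x → (h x ≡ c1) ⇔ (x ∈ M)) where
  open H3Algebra A
  open IsMaximalModalDS isMaximal
  open IsModalDS isModalDS
  open ModalDSProperties A isModalDS

  h≢c1⇒∉ : ∀ {x c} → h x ≡ c → c ≢ c1 → x ∉ M
  h≢c1⇒∉ {x} hx≡c c≢c1 x∈M = c≢c1 (trans (sym hx≡c) (from (h≡c1⇔∈ x) x∈M))

  _∈M? : Decidable M
  x ∈M? with h x in hx≡c
  ... | c0 = no (h≢c1⇒∉ hx≡c λ ())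
  ... | c½ = no (h≢c1⇒∉ hx≡c λ ())
  ... | c1 = yes (to (h≡c1⇔∈ x) hx≡c)

  open MaximalModalDSProperties A isMaximal _∈M?

  h≡c0 : ∀ {x} → Explosive x → h x ≡ c0
  h≡c0 x-explosive = from (h≡c0⇔∇∉ _) (explosive⇒∇∉ x-explosive)

  h≡c½ : ∀ {x} → Intermediate x → h x ≡ c½
  h≡c½ = from (h≡c½⇔ _)

  h≡c1 : ∀ {x} → x ∈ M → h x ≡ c1
  h≡c1 = from (h≡c1⇔∈ _)

  explosive : ∀ {x} → h x ≡ c0 → Explosive x
  explosive hx≡c0 = ∇∉⇒explosive (to (h≡c0⇔∇∉ _) hx≡c0)

  intermediate : ∀ {x} → h x ≡ c½ → Intermediate x
  intermediate = to (h≡c½⇔ _)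

  ∈M : ∀ {x} → h x ≡ c1 → x ∈ M
  ∈M = to (h≡c1⇔∈ _)

  hom-⇒ : ∀ x y → h (x ⇒ y) ≡ h x ⇒C h y
  hom-⇒ x y with h x in hx | h y in hy
  ... | c0 | _  = h≡c1 (explosive hx y)
  ... | c½ | c0 = h≡c0 (intermediate-⇒-explosive (intermediate hx) (explosive hy))
  ... | c½ | c½ = h≡c1 (∉-⇒-intermediate-∈ (proj₁ (intermediate hx)) (intermediate hy))
  ... | c½ | c1 = h≡c1 (weaken (∈M hy))
  ... | c1 | c0 = h≡c0 (∈-⇒-explosive (∈M hx) (explosive hy))
  ... | c1 | c½ = h≡c½ (∈-⇒-intermediate (∈M hx) (intermediate hy))
  ... | c1 | c1 = h≡c1 (weaken (∈M hy))

  hom-△ : ∀ x → h (△ x) ≡ △C (h x)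
  hom-△ x with h x in hx
  ... | c0 = h≡c0 (△-explosive (h≢c1⇒∉ hx λ ()))
  ... | c½ = h≡c0 (△-explosive (h≢c1⇒∉ hx λ ()))
  ... | c1 = h≡c1 (nec (∈M hx))

  hom-∨ : ∀ x y → h (x ∨ y) ≡ h x ∨C h y
  hom-∨ x y = ∨C-unique (h x) (h y) (h (x ∨ y))
    (h-⇒≡c1 (ax∨1 x y))
    (h-⇒≡c1 (subst (λ t → y ⇒ t ≡ 𝟙) (∨-comm y x) (ax∨1 y x)))
    (h-⇒⇒≡c1 (ax∨2 x y))
    (h-⇒⇒≡c1 (subst (λ t → (y ⇒ x) ⇒ (t ⇒ x) ≡ 𝟙) (∨-comm y x) (ax∨2 y x)))
    where
    h-⇒≡c1 : ∀ {a b} → a ⇒ b ≡ 𝟙 → h a ⇒C h b ≡ c1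
    h-⇒≡c1 {a} {b} eq = trans (sym (hom-⇒ a b)) (h≡c1 (≡𝟙⇒∈ eq))
    h-⇒⇒≡c1 : ∀ {a b c d} → (a ⇒ b) ⇒ (c ⇒ d) ≡ 𝟙 →
              (h a ⇒C h b) ⇒C (h c ⇒C h d) ≡ c1
    h-⇒⇒≡c1 {a} {b} {c} {d} eq =
      trans (sym (cong₂ _⇒C_ (hom-⇒ a b) (hom-⇒ c d))) (h-⇒≡c1 eq)

  isHom : IsHom A h
  isHom = record
    { hom-⇒ = hom-⇒ ; hom-∨ = hom-∨ ; hom-△ = hom-△ ; hom-1 = h≡c1 one∈ }

-- NonTrivial M is unused: it coincides with Proper M, part of maximality.
mainTheorem10 : (A : H3Algebra) → let open H3Algebra A in
    (M : Pred Carrier 0ℓ) → IsMaximalModalDS M → NonTrivial M →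
    (h : Carrier → C3) →
    (∀ x → (h x ≡ c0) ⇔ (∇ x ∉ M)) →
    (∀ x → (h x ≡ c½) ⇔ (x ∉ M × ∇ x ∈ M)) →
    (∀ x → (h x ≡ c1) ⇔ (x ∈ M)) →
    IsHom A h × (∀ x → (h x ≡ c1) ⇔ (x ∈ M))
mainTheorem10 A M isMaximal _ h h≡c0⇔ h≡c½⇔ h≡c1⇔ =
  isHom , h≡c1⇔
  where open Classification A isMaximal h h≡c0⇔ h≡c½⇔ h≡c1⇔
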